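{- Let $N$ be a positive integer and let $P$ be a polyomino of minimum size among polyominoes containing at least $N$ instances of the L tromino, and suppose $P$ has width $w$ and height $h$. Then $$|P|=|X_c|+|S_t|+|S_r|+|S_{t,r}|$$ and $$|P|\ge |X_c|+\max(w,h).$$
   Context: Cells are the unit squares of the square lattice, indexed by integer coordinates $(x,y)$ with $y$ increasing upward. A polyomino is a finite nonempty edge-connected set of cells; its size $|P|$ is its number of cells; its width is the number of columns and its height the number of rows occupied by its cells. The L tromino is $\{(0,0),(1,0),(0,1)\}$, with central cell $(0,0)$, right cell $(1,0)$, top cell $(0,1)$; an instance is a translate of it. Let $X_t$ (resp. $X_r$, $X_c$) be the set of cells of $P$ that are the top (resp. right, central) cell of some instance of the L tromino contained in $P$. Define $S_t=X_t\setminus(X_r\cup X_c)$, $S_r=X_r\setminus(X_t\cup X_c)$, and $S_{t,r}=(X_t\cap X_r)\setminus X_c$. -}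

module Defs where

open import Data.Nat using (ℕ; _⊔_)
open import Data.Integer as ℤ using (ℤ; _+_; _-_; 0ℤ; 1ℤ)
open import Data.Product using (_×_; _,_; proj₁; proj₂)
open import Data.Product.Properties using (≡-dec)
open import Data.Sum using (_⊎_)
open import Data.List using (List; []; _∷_; length; filter; map; deduplicate)
open import Data.List.Relation.Unary.Unique.Propositional using (Unique)
open import Data.List.Membership.Propositional using (_∈_)
import Data.List.Membership.DecPropositional as DecMem
open import Relation.Binary.PropositionalEquality using (_≡_)
open import Relation.Binary using (DecidableEquality)
open import Relation.Nullary using (¬_; ¬?)
open import Relation.Nullary.Decidable using (_×-dec_)
open import Relation.Unary using (Decidable)

-- A cell (x , y) of the square lattice; y increases upward.
Cell : Set
Cell = ℤ × ℤ

_≟ᶜ_ : DecidableEquality Cell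
_≟ᶜ_ = ≡-dec ℤ._≟_ ℤ._≟_

open DecMem _≟ᶜ_ using (_∈?_)

shift : ℤ → ℤ → Cell → Cell
shift dx dy (x , y) = (x + dx , y + dy)

Adjacent : Cell → Cell → Set
Adjacent c d = (d ≡ shift 1ℤ 0ℤ c ⊎ d ≡ shift (ℤ.- 1ℤ) 0ℤ c)
             ⊎ (d ≡ shift 0ℤ 1ℤ c ⊎ d ≡ shift 0ℤ (ℤ.- 1ℤ) c)

data Reach (cs : List Cell) : Cell → Cell → Set where
  here : ∀ {c} → Reach cs c c
  step : ∀ {c d e} → d ∈ cs → Adjacent c d → Reach cs d e → Reach cs c e

record Polyomino : Set where
  field
    cells     : List Cell
    unique    : Unique cells
    nonempty  : ¬ (cells ≡ [])
    connected : ∀ {c d} → c ∈ cells → d ∈ cells → Reach cells c d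
open Polyomino public

size : Polyomino → ℕ
size P = length (cells P)

width : Polyomino → ℕ
width P = length (deduplicate ℤ._≟_ (map proj₁ (cells P)))

height : Polyomino → ℕ
height P = length (deduplicate ℤ._≟_ (map proj₂ (cells P)))

-- The translate of the L tromino {(0,0),(1,0),(0,1)} by the vector t is
-- contained in P.  (Instances are translates, indexed by the vector t.)
LIn : Polyomino → Cell → Set
LIn P t = (shift 0ℤ 0ℤ t ∈ cells P × shift 1ℤ 0ℤ t ∈ cells P) × shift 0ℤ 1ℤ t ∈ cells P

LIn? : (P : Polyomino) → Decidable (LIn P)
LIn? P t = ((shift 0ℤ 0ℤ t ∈? cells P) ×-dec (shift 1ℤ 0ℤ t ∈? cells P))
           ×-dec (shift 0ℤ 1ℤ t ∈? cells P)

-- number of instances of the L tromino contained in P; a translate with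
-- vector t can only be contained in P if t ∈ P, so it suffices to range
-- over the cells of P.
instances : Polyomino → ℕ
instances P = length (filter (LIn? P) (cells P))

-- c is the central / right / top cell of some instance contained in P
-- (the instance with central cell c' has translation vector c').
IsC IsR IsT : Polyomino → Cell → Set
IsC P c = LIn P c
IsR P c = LIn P (shift (ℤ.- 1ℤ) 0ℤ c)
IsT P c = LIn P (shift 0ℤ (ℤ.- 1ℤ) c)

IsC? : (P : Polyomino) → Decidable (IsC P)
IsR? : (P : Polyomino) → Decidable (IsR P)
IsT? : (P : Polyomino) → Decidable (IsT P)
IsC? P c = LIn? P c
IsR? P c = LIn? P (shift (ℤ.- 1ℤ) 0ℤ c)
IsT? P c = LIn? P (shift 0ℤ (ℤ.- 1ℤ) c)

Xc Xr Xt St Sr Str : Polyomino → List Cell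
Xc P = filter (IsC? P) (cells P)
Xr P = filter (IsR? P) (cells P)
Xt P = filter (IsT? P) (cells P)
St P = filter (λ c → IsT? P c ×-dec (¬? (IsR? P c) ×-dec ¬? (IsC? P c))) (cells P)
Sr P = filter (λ c → IsR? P c ×-dec (¬? (IsT? P c) ×-dec ¬? (IsC? P c))) (cells P)
Str P = filter (λ c → (IsT? P c ×-dec IsR? P c) ×-dec ¬? (IsC? P c)) (cells P)

MinimalFor : ℕ → Polyomino → Set
MinimalFor N P = (N Data.Nat.≤ instances P)
               × (∀ (Q : Polyomino) → N Data.Nat.≤ instances Q → size P Data.Nat.≤ size Q)

{-# OPTIONS --safe #-}
module Submission where

-- Minimality forces every cell of P into X_c ∪ X_t ∪ X_r: a cell lying in no instance can be
-- deleted without losing an instance, and the components of what remains, placed side by side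
-- so that consecutive ones touch, form a smaller polyomino with at least as many instances.
-- The identity is then the partition of P according to membership in X_c, X_t and X_r.
-- For the inequality, the topmost cell of each column and the rightmost cell of each row are
-- not central, so at least max(w, h) cells of P lie outside X_c.

open import Defs
open import Data.Nat using (ℕ; suc; z≤n; s≤s; _+_; _≤_; _<_; _⊔_; NonZero; >-nonZero⁻¹)
import Data.Nat.Properties as ℕₚ
open import Data.Nat.Induction using (<-wellFounded)
open import Data.Integer as ℤ using (ℤ; 0ℤ; 1ℤ)
import Data.Integer.Properties as ℤₚ
open import Data.Integer.Tactic.RingSolver using (solve-∀)
open import Data.Product using (_×_; _,_; proj₁; proj₂; Σ-syntax)
open import Data.Sum using (_⊎_; inj₁; inj₂)
open import Data.List using (List; []; _∷_; _++_; length; filter; map; deduplicate)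
open import Data.List.Properties using (length-++; length-map; filter-notAll)
open import Data.List.Membership.Propositional using (_∈_)
open import Data.List.Membership.Propositional.Properties
  using (∈-map⁺; ∈-map⁻; ∈-++⁺ˡ; ∈-++⁺ʳ; ∈-++⁻; ∈-filter⁺; ∈-filter⁻; ∈-∃++; ∈-deduplicate⁻)
open import Data.List.Membership.DecPropositional _≟ᶜ_ using (_∈?_)
open import Data.List.Relation.Unary.Any as Any using (here; there)
open import Data.List.Relation.Unary.All as All using (All)
open import Data.List.Relation.Unary.Unique.Propositional using (Unique; _∷_)
import Data.List.Relation.Unary.Unique.Propositional.Properties as Unique
import Data.List.Relation.Unary.Unique.DecPropositional.Properties as UniqueDec
open import Data.List.Relation.Binary.Subset.Propositional using (_⊆_)
open import Data.List.Relation.Binary.Disjoint.Propositional using (Disjoint)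
open import Data.List.Extrema ℤₚ.≤-totalOrder
  using (argmax; argmin; argmax-all; argmin-all; f[xs]≤f[argmax]; f[argmin]≤f[xs])
open import Function using (id; _∘_; _on_)
open import Induction.WellFounded using (Acc; acc)
import Relation.Binary.Construct.On as On
open import Relation.Binary.PropositionalEquality using (_≡_; _≢_; refl; sym; trans; cong; cong₂; subst; module ≡-Reasoning)
open import Relation.Nullary using (¬_; Dec; yes; no; ¬?; contradiction)
open import Relation.Nullary.Decidable using (_×-dec_; _⊎-dec_; decidable-stable; ¬¬-excluded-middle)
open import Relation.Nullary.Negation using (¬¬-Monad; ¬¬-map)
open import Relation.Binary using (DecidableEquality)
open import Relation.Unary using (Decidable)
open import Relation.Unary.Properties using (∁?)
open import Effect.Monad using (RawMonad)

module _ {A : Set} where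

  ∈⇒≢[] : ∀ {x : A} {xs} → x ∈ xs → xs ≢ []
  ∈⇒≢[] (here _)  ()
  ∈⇒≢[] (there _) ()

  length-mono-⊆ : {xs ys : List A} → Unique xs → xs ⊆ ys → length xs ≤ length ys
  length-mono-⊆ {[]}     _           _     = z≤n
  length-mono-⊆ {x ∷ xs} (x∉xs ∷ u) xs⊆ys with ∈-∃++ (xs⊆ys (here refl))
  ... | us , vs , refl = begin
    suc (length xs)                ≤⟨ s≤s (length-mono-⊆ u xs⊆us++vs) ⟩
    suc (length (us ++ vs))        ≡⟨ cong suc (length-++ us {vs}) ⟩
    suc (length us + length vs)    ≡⟨ ℕₚ.+-suc (length us) (length vs) ⟨
    length us + length (x ∷ vs)    ≡⟨ length-++ us {x ∷ vs} ⟨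
    length (us ++ x ∷ vs)          ∎
    where
    open ℕₚ.≤-Reasoning
    xs⊆us++vs : xs ⊆ us ++ vs
    xs⊆us++vs {y} y∈xs with ∈-++⁻ us (xs⊆ys (there y∈xs))
    ... | inj₁ y∈us         = ∈-++⁺ˡ y∈us
    ... | inj₂ (here y≡x)   = contradiction (sym y≡x) (All.lookup x∉xs y∈xs)
    ... | inj₂ (there y∈vs) = ∈-++⁺ʳ us y∈vs

  length-filter-∁ : {P : A → Set} (P? : Decidable P) (xs : List A) →
                    length (filter P? xs) + length (filter (∁? P?) xs) ≡ length xs
  length-filter-∁ P? []       = refl
  length-filter-∁ P? (x ∷ xs) with P? x
  ... | yes _ = cong suc (length-filter-∁ P? xs)
  ... | no  _ = trans (ℕₚ.+-suc _ _) (cong suc (length-filter-∁ P? xs))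

  module _ {C T R : A → Set} (C? : Decidable C) (T? : Decidable T) (R? : Decidable R) where

    #C #T #R #TR : List A → ℕ
    #C  = length ∘ filter C?
    #T  = length ∘ filter (λ x → T? x ×-dec (¬? (R? x) ×-dec ¬? (C? x)))
    #R  = length ∘ filter (λ x → R? x ×-dec (¬? (T? x) ×-dec ¬? (C? x)))
    #TR = length ∘ filter (λ x → (T? x ×-dec R? x) ×-dec ¬? (C? x))

    length-cover : ∀ xs → (∀ {x} → x ∈ xs → C x ⊎ T x ⊎ R x) →
                   length xs ≡ #C xs + #T xs + #R xs + #TR xs
    length-cover []       _     = refl
    length-cover (x ∷ xs) cover with length-cover xs (cover ∘ there) | C? x | T? x | R? x
    ... | ih | yes _ | yes _ | yes _ = cong suc ih
    ... | ih | yes _ | yes _ | no _  = cong suc ih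
    ... | ih | yes _ | no _  | yes _ = cong suc ih
    ... | ih | yes _ | no _  | no _  = cong suc ih
    ... | ih | no _  | yes _ | no _  =
      trans (cong suc ih) (sym (cong (λ n → n + #R xs + #TR xs) (ℕₚ.+-suc (#C xs) (#T xs))))
    ... | ih | no _  | no _  | yes _ =
      trans (cong suc ih) (sym (cong (_+ #TR xs) (ℕₚ.+-suc (#C xs + #T xs) (#R xs))))
    ... | ih | no _  | yes _ | yes _ =
      trans (cong suc ih) (sym (ℕₚ.+-suc (#C xs + #T xs + #R xs) (#TR xs)))
    ... | _  | no ¬c | no ¬t | no ¬r with cover (here refl)
    ...   | inj₁ c        = contradiction c ¬c
    ...   | inj₂ (inj₁ t) = contradiction t ¬t
    ...   | inj₂ (inj₂ r) = contradiction r ¬r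

  length-deduplicate-⊆ : (_≟_ : DecidableEquality A) {xs ys : List A} →
                         xs ⊆ ys → length (deduplicate _≟_ xs) ≤ length ys
  length-deduplicate-⊆ _≟_ {xs} xs⊆ys =
    length-mono-⊆ (UniqueDec.deduplicate-! _≟_ xs) (xs⊆ys ∘ ∈-deduplicate⁻ _≟_ xs)

  module _ (f : A → ℤ) {c : A} {xs : List A} (c∈xs : c ∈ xs) where

    maximiser : Σ[ m ∈ A ] m ∈ xs × (∀ {x} → x ∈ xs → f x ℤ.≤ f m)
    maximiser = argmax f c xs , argmax-all f c∈xs (All.tabulate id) , All.lookup (f[xs]≤f[argmax] c xs)

    minimiser : Σ[ m ∈ A ] m ∈ xs × (∀ {x} → x ∈ xs → f m ℤ.≤ f x)
    minimiser = argmin f c xs , argmin-all f c∈xs (All.tabulate id) , All.lookup (f[argmin]≤f[xs] c xs)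

shift-zero : ∀ c → shift 0ℤ 0ℤ c ≡ c
shift-zero (x , y) = cong₂ _,_ (ℤₚ.+-identityʳ x) (ℤₚ.+-identityʳ y)

shift-inverse : ∀ a b c → shift (ℤ.- a) (ℤ.- b) (shift a b c) ≡ c
shift-inverse a b (x , y) = cong₂ _,_ (cancel x a) (cancel y b)
  where
  cancel : ∀ x a → x ℤ.+ a ℤ.+ ℤ.- a ≡ x
  cancel = solve-∀

shift-comm : ∀ a b a′ b′ c → shift a b (shift a′ b′ c) ≡ shift a′ b′ (shift a b c)
shift-comm a b a′ b′ (x , y) = cong₂ _,_ (swap x a a′) (swap y b b′)
  where
  swap : ∀ x a a′ → x ℤ.+ a′ ℤ.+ a ≡ x ℤ.+ a ℤ.+ a′
  swap = solve-∀

shift-injective : ∀ a b {c d} → shift a b c ≡ shift a b d → c ≡ d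
shift-injective a b {c} {d} eq = begin
  c                                          ≡⟨ shift-inverse a b c ⟨
  shift (ℤ.- a) (ℤ.- b) (shift a b c)        ≡⟨ cong (shift (ℤ.- a) (ℤ.- b)) eq ⟩
  shift (ℤ.- a) (ℤ.- b) (shift a b d)        ≡⟨ shift-inverse a b d ⟩
  d                                          ∎
  where open ≡-Reasoning

i<i+1 : ∀ i → i ℤ.< i ℤ.+ 1ℤ
i<i+1 i = ℤₚ.suc[i]≤j⇒i<j (ℤₚ.≤-reflexive (ℤₚ.+-comm 1ℤ i))

Adjacent-sym : ∀ {c d} → Adjacent c d → Adjacent d c
Adjacent-sym {c} (inj₁ (inj₁ refl)) = inj₁ (inj₂ (sym (shift-inverse 1ℤ 0ℤ c)))
Adjacent-sym {c} (inj₁ (inj₂ refl)) = inj₁ (inj₁ (sym (shift-inverse (ℤ.- 1ℤ) 0ℤ c)))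
Adjacent-sym {c} (inj₂ (inj₁ refl)) = inj₂ (inj₂ (sym (shift-inverse 0ℤ 1ℤ c)))
Adjacent-sym {c} (inj₂ (inj₂ refl)) = inj₂ (inj₁ (sym (shift-inverse 0ℤ (ℤ.- 1ℤ) c)))

Adjacent-shift : ∀ a b {c d} → Adjacent c d → Adjacent (shift a b c) (shift a b d)
Adjacent-shift a b {c} (inj₁ (inj₁ refl)) = inj₁ (inj₁ (shift-comm a b _ _ c))
Adjacent-shift a b {c} (inj₁ (inj₂ refl)) = inj₁ (inj₂ (shift-comm a b _ _ c))
Adjacent-shift a b {c} (inj₂ (inj₁ refl)) = inj₂ (inj₁ (shift-comm a b _ _ c))
Adjacent-shift a b {c} (inj₂ (inj₂ refl)) = inj₂ (inj₂ (shift-comm a b _ _ c))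

adjacent-right : ∀ t → Adjacent t (shift 1ℤ 0ℤ t)
adjacent-right t = inj₁ (inj₁ refl)

adjacent-up : ∀ t → Adjacent t (shift 0ℤ 1ℤ t)
adjacent-up t = inj₂ (inj₁ refl)

module _ {cs : List Cell} where

  Reach-trans : ∀ {a b c} → Reach cs a b → Reach cs b c → Reach cs a c
  Reach-trans here             q = q
  Reach-trans (step m adj p) q = step m adj (Reach-trans p q)

  Reach-snoc : ∀ {a b c} → Reach cs a b → c ∈ cs → Adjacent b c → Reach cs a c
  Reach-snoc p c∈cs b~c = Reach-trans p (step c∈cs b~c here)

  Reach-sym : ∀ {a b} → a ∈ cs → Reach cs a b → Reach cs b a
  Reach-sym a∈cs here              = here
  Reach-sym a∈cs (step d∈cs a~d p) = Reach-snoc (Reach-sym d∈cs p) a∈cs (Adjacent-sym a~d)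

  Reach-target∈ : ∀ {a b} → a ∈ cs → Reach cs a b → b ∈ cs
  Reach-target∈ a∈cs here            = a∈cs
  Reach-target∈ a∈cs (step d∈cs _ p) = Reach-target∈ d∈cs p

  connected-via : ∀ {a} → a ∈ cs → (∀ {x} → x ∈ cs → Reach cs a x) →
                  ∀ {c d} → c ∈ cs → d ∈ cs → Reach cs c d
  connected-via a∈cs reach c∈cs d∈cs = Reach-trans (Reach-sym a∈cs (reach c∈cs)) (reach d∈cs)

Reach-mono : ∀ {cs ds a b} → cs ⊆ ds → Reach cs a b → Reach ds a b
Reach-mono cs⊆ds here           = here
Reach-mono cs⊆ds (step m adj p) = step (cs⊆ds m) adj (Reach-mono cs⊆ds p)

Reach-shift : ∀ a b {cs c d} → Reach cs c d → Reach (map (shift a b) cs) (shift a b c) (shift a b d)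
Reach-shift a b here           = here
Reach-shift a b {c = c} (step {d = d} m adj p) =
  step (∈-map⁺ (shift a b) m) (Adjacent-shift a b {c} {d} adj) (Reach-shift a b p)

nonCentral : Polyomino → List Cell
nonCentral P = filter (∁? (IsC? P)) (cells P)

-- Lines are the level sets of key, traversed by next in increasing val: columns with the
-- top neighbour, rows with the right neighbour.  The last cell of a line is not central.
module LineEnds (P : Polyomino) (key val : Cell → ℤ) (next : Cell → Cell)
  (key-next : ∀ c → key (next c) ≡ key c) (val-next : ∀ c → val c ℤ.< val (next c))
  (central⇒next∈ : ∀ {c} → IsC P c → next c ∈ cells P) where

  on-line? : ∀ c → Decidable (λ d → key d ≡ key c)
  on-line? c d = key d ℤ.≟ key c

  keys⊆nonCentral-keys : map key (cells P) ⊆ map key (nonCentral P)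
  keys⊆nonCentral-keys k∈keys with ∈-map⁻ key k∈keys
  ... | c , c∈P , refl with maximiser val (∈-filter⁺ (on-line? c) c∈P refl)
  ... | m , m∈line , m-last with ∈-filter⁻ (on-line? c) {xs = cells P} m∈line
  ... | m∈P , key-m =
    subst (_∈ map key (nonCentral P)) key-m (∈-map⁺ key (∈-filter⁺ (∁? (IsC? P)) m∈P m-not-central))
    where
    m-not-central : ¬ IsC P m
    m-not-central m-central = ℤₚ.<⇒≱ (val-next m)
      (m-last (∈-filter⁺ (on-line? c) (central⇒next∈ m-central) (trans (key-next m) key-m)))

  #keys≤#nonCentral : length (deduplicate ℤ._≟_ (map key (cells P))) ≤ length (nonCentral P)
  #keys≤#nonCentral = begin
    length (deduplicate ℤ._≟_ (map key (cells P)))  ≤⟨ length-deduplicate-⊆ ℤ._≟_ keys⊆nonCentral-keys ⟩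
    length (map key (nonCentral P))                 ≡⟨ length-map key (nonCentral P) ⟩
    length (nonCentral P)                           ∎
    where open ℕₚ.≤-Reasoning

width≤#nonCentral : ∀ P → width P ≤ length (nonCentral P)
width≤#nonCentral P =
  LineEnds.#keys≤#nonCentral P proj₁ proj₂ (shift 0ℤ 1ℤ) (ℤₚ.+-identityʳ ∘ proj₁) (i<i+1 ∘ proj₂) proj₂

height≤#nonCentral : ∀ P → height P ≤ length (nonCentral P)
height≤#nonCentral P =
  LineEnds.#keys≤#nonCentral P proj₂ proj₁ (shift 1ℤ 0ℤ) (ℤₚ.+-identityʳ ∘ proj₂) (i<i+1 ∘ proj₁) (proj₂ ∘ proj₁)

#central+width⊔height≤size : ∀ P → length (Xc P) + (width P ⊔ height P) ≤ size P
#central+width⊔height≤size P = begin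
  length (Xc P) + (width P ⊔ height P)
    ≤⟨ ℕₚ.+-monoʳ-≤ (length (Xc P)) (ℕₚ.⊔-lub (width≤#nonCentral P) (height≤#nonCentral P)) ⟩
  length (Xc P) + length (nonCentral P)
    ≡⟨ length-filter-∁ (IsC? P) (cells P) ⟩
  size P
    ∎
  where open ℕₚ.≤-Reasoning

-- LIn and instances for an arbitrary list of cells; on cells P they are definitionally
-- LIn P and instances P.
LInCells : List Cell → Cell → Set
LInCells S t = (shift 0ℤ 0ℤ t ∈ S × shift 1ℤ 0ℤ t ∈ S) × shift 0ℤ 1ℤ t ∈ S

LInCells? : (S : List Cell) → Decidable (LInCells S)
LInCells? S t = ((shift 0ℤ 0ℤ t ∈? S) ×-dec (shift 1ℤ 0ℤ t ∈? S)) ×-dec (shift 0ℤ 1ℤ t ∈? S)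

instancesIn : List Cell → ℕ
instancesIn S = length (filter (LInCells? S) S)

LInCells-mono : ∀ {S S′ t} → S ⊆ S′ → LInCells S t → LInCells S′ t
LInCells-mono S⊆S′ ((p , q) , r) = (S⊆S′ p , S⊆S′ q) , S⊆S′ r

LInCells-shift : ∀ a b {S t} → LInCells S t → LInCells (map (shift a b) S) (shift a b t)
LInCells-shift a b {S} {t} ((p , q) , r) = (moved 0ℤ 0ℤ p , moved 1ℤ 0ℤ q) , moved 0ℤ 1ℤ r
  where
  moved : ∀ i j → shift i j t ∈ S → shift i j (shift a b t) ∈ map (shift a b) S
  moved i j m = subst (_∈ map (shift a b) S) (shift-comm a b i j t) (∈-map⁺ (shift a b) m)

LInCells-filter⁺ : ∀ {R : Cell → Set} (R? : Decidable R) {S t} → LInCells S t →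
  R (shift 0ℤ 0ℤ t) → R (shift 1ℤ 0ℤ t) → R (shift 0ℤ 1ℤ t) → LInCells (filter R? S) t
LInCells-filter⁺ R? ((p , q) , r) a b c = (∈-filter⁺ R? p a , ∈-filter⁺ R? q b) , ∈-filter⁺ R? r c

instancesIn-map-shift : ∀ a b {S} → Unique S → instancesIn S ≤ instancesIn (map (shift a b) S)
instancesIn-map-shift a b {S} u = begin
  instancesIn S                   ≡⟨ length-map (shift a b) I ⟨
  length (map (shift a b) I)      ≤⟨ length-mono-⊆ (Unique.map⁺ (shift-injective a b) (Unique.filter⁺ (LInCells? S) u)) moved ⟩
  instancesIn (map (shift a b) S) ∎
  where
  open ℕₚ.≤-Reasoning
  I = filter (LInCells? S) S
  moved : map (shift a b) I ⊆ filter (LInCells? (map (shift a b) S)) (map (shift a b) S)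
  moved t′∈ with ∈-map⁻ (shift a b) t′∈
  ... | t , t∈I , refl with ∈-filter⁻ (LInCells? S) {xs = S} t∈I
  ... | t∈S , inst = ∈-filter⁺ (LInCells? _) (∈-map⁺ (shift a b) t∈S) (LInCells-shift a b {t = t} inst)

instancesIn-++ : ∀ {xs ys} → Unique xs → Unique ys → Disjoint xs ys →
                 instancesIn xs + instancesIn ys ≤ instancesIn (xs ++ ys)
instancesIn-++ {xs} {ys} uxs uys xs∩ys=∅ = begin
  instancesIn xs + instancesIn ys  ≡⟨ length-++ I ⟨
  length (I ++ J)                  ≤⟨ length-mono-⊆ (Unique.++⁺ (Unique.filter⁺ _ uxs) (Unique.filter⁺ _ uys) I∩J=∅) I++J⊆ ⟩
  instancesIn (xs ++ ys)           ∎
  where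
  open ℕₚ.≤-Reasoning
  I = filter (LInCells? xs) xs
  J = filter (LInCells? ys) ys
  I∩J=∅ : Disjoint I J
  I∩J=∅ (t∈I , t∈J) = xs∩ys=∅ (proj₁ (∈-filter⁻ (LInCells? xs) t∈I) , proj₁ (∈-filter⁻ (LInCells? ys) t∈J))
  inˡ : xs ⊆ xs ++ ys
  inˡ = ∈-++⁺ˡ
  inʳ : ys ⊆ xs ++ ys
  inʳ = ∈-++⁺ʳ xs
  I++J⊆ : I ++ J ⊆ filter (LInCells? (xs ++ ys)) (xs ++ ys)
  I++J⊆ {t} t∈ with ∈-++⁻ I t∈
  ... | inj₁ t∈I = let (t∈xs , inst) = ∈-filter⁻ (LInCells? xs) t∈I
                   in ∈-filter⁺ (LInCells? (xs ++ ys)) (inˡ t∈xs) (LInCells-mono {t = t} inˡ inst)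
  ... | inj₂ t∈J = let (t∈ys , inst) = ∈-filter⁻ (LInCells? ys) t∈J
                   in ∈-filter⁺ (LInCells? (xs ++ ys)) (inʳ t∈ys) (LInCells-mono {t = t} inʳ inst)

instancesIn-filter : ∀ {R : Cell → Set} (R? : Decidable R) {S} → Unique S →
  (∀ {t} → LInCells S t → (R (shift 0ℤ 0ℤ t) × R (shift 1ℤ 0ℤ t)) × R (shift 0ℤ 1ℤ t)) →
  instancesIn S ≤ instancesIn (filter R? S)
instancesIn-filter {R} R? {S} u onR = length-mono-⊆ (Unique.filter⁺ (LInCells? S) u) kept
  where
  kept : filter (LInCells? S) S ⊆ filter (LInCells? (filter R? S)) (filter R? S)
  kept {t} t∈I with ∈-filter⁻ (LInCells? S) {xs = S} t∈I
  ... | t∈S , inst with onR {t} inst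
  ... | (r₀ , r₁) , r₂ = ∈-filter⁺ (LInCells? (filter R? S)) (∈-filter⁺ R? t∈S (subst R (shift-zero t) r₀))
                           (LInCells-filter⁺ R? {t = t} inst r₀ r₁ r₂)

instancesIn-split : ∀ {Q : Cell → Set} (Q? : Decidable Q) {S} → Unique S →
  (∀ {c d} → d ∈ S → Adjacent c d → Q c → Q d) →
  instancesIn S ≤ instancesIn (filter Q? S) + instancesIn (filter (∁? Q?) S)
instancesIn-split {Q} Q? {S} u closed = begin
  instancesIn S                              ≤⟨ length-mono-⊆ (Unique.filter⁺ (LInCells? S) u) split ⟩
  length (I₊ ++ I₋)                          ≡⟨ length-++ I₊ ⟩
  instancesIn S₊ + instancesIn S₋            ∎
  where
  open ℕₚ.≤-Reasoning
  S₊ = filter Q? S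
  S₋ = filter (∁? Q?) S
  I₊ = filter (LInCells? S₊) S₊
  I₋ = filter (LInCells? S₋) S₋
  split : filter (LInCells? S) S ⊆ I₊ ++ I₋
  split {t} t∈I with ∈-filter⁻ (LInCells? S) {xs = S} t∈I
  ... | t∈S , inst@((_ , t→∈S) , t↑∈S) with Q? t
  ... | yes Qt = ∈-++⁺ˡ (∈-filter⁺ (LInCells? S₊) (∈-filter⁺ Q? t∈S Qt)
                   (LInCells-filter⁺ Q? {t = t} inst (subst Q (sym (shift-zero t)) Qt)
                      (closed t→∈S (adjacent-right t) Qt) (closed t↑∈S (adjacent-up t) Qt)))
  ... | no ¬Qt = ∈-++⁺ʳ I₊ (∈-filter⁺ (LInCells? S₋) (∈-filter⁺ (∁? Q?) t∈S ¬Qt)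
                   (LInCells-filter⁺ (∁? Q?) {t = t} inst (¬Qt ∘ subst Q (shift-zero t))
                      (¬Qt ∘ closed t∈S (Adjacent-sym {t} (adjacent-right t)))
                      (¬Qt ∘ closed t∈S (Adjacent-sym {t} (adjacent-up t)))))

some-cell : (P : Polyomino) → Σ[ c ∈ Cell ] c ∈ cells P
some-cell P with cells P | nonempty P
... | []    | ne = contradiction refl ne
... | c ∷ _ | _  = c , here refl

translate : ℤ → ℤ → Polyomino → Polyomino
translate a b P = record
  { cells     = map (shift a b) (cells P)
  ; unique    = Unique.map⁺ (shift-injective a b) (unique P)
  ; nonempty  = ∈⇒≢[] (∈-map⁺ (shift a b) (proj₂ (some-cell P)))
  ; connected = connected′
  }
  where
  connected′ : ∀ {c d} → c ∈ map (shift a b) (cells P) → d ∈ map (shift a b) (cells P) →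
               Reach (map (shift a b) (cells P)) c d
  connected′ c∈ d∈ with ∈-map⁻ (shift a b) c∈ | ∈-map⁻ (shift a b) d∈
  ... | _ , c∈P , refl | _ , d∈P , refl = Reach-shift a b (connected P c∈P d∈P)

module Union (P Q : Polyomino) (P∩Q=∅ : Disjoint (cells P) (cells Q))
             {a b : Cell} (a∈P : a ∈ cells P) (b∈Q : b ∈ cells Q) (a~b : Adjacent a b) where

  private
    inˡ : cells P ⊆ cells P ++ cells Q
    inˡ = ∈-++⁺ˡ
    inʳ : cells Q ⊆ cells P ++ cells Q
    inʳ = ∈-++⁺ʳ (cells P)

    reach-from-a : ∀ {x} → x ∈ cells P ++ cells Q → Reach (cells P ++ cells Q) a x
    reach-from-a x∈ with ∈-++⁻ (cells P) x∈
    ... | inj₁ x∈P = Reach-mono inˡ (connected P a∈P x∈P)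
    ... | inj₂ x∈Q = step (inʳ b∈Q) a~b (Reach-mono inʳ (connected Q b∈Q x∈Q))

  polyomino : Polyomino
  polyomino = record
    { cells     = cells P ++ cells Q
    ; unique    = Unique.++⁺ (unique P) (unique Q) P∩Q=∅
    ; nonempty  = ∈⇒≢[] (inˡ a∈P)
    ; connected = connected-via (inˡ a∈P) reach-from-a
    }

  size-≡ : size polyomino ≡ size P + size Q
  size-≡ = length-++ (cells P)

  instances-≥ : instances P + instances Q ≤ instances polyomino
  instances-≥ = instancesIn-++ (unique P) (unique Q) P∩Q=∅

-- Q is translated so that its leftmost cell lands just right of the rightmost cell of P.
module Juxtapose (P Q : Polyomino) where

  private
    rightmost = maximiser proj₁ (proj₂ (some-cell P))
    leftmost  = minimiser proj₁ (proj₂ (some-cell Q))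
    a = proj₁ rightmost
    b = proj₁ leftmost
    dx = proj₁ a ℤ.+ 1ℤ ℤ.- proj₁ b
    dy = proj₂ a ℤ.- proj₂ b

    b↦right-of-a : shift dx dy b ≡ shift 1ℤ 0ℤ a
    b↦right-of-a = cong₂ _,_ (move-x (proj₁ b) (proj₁ a)) (move-y (proj₂ b) (proj₂ a))
      where
      move-x : ∀ u v → u ℤ.+ (v ℤ.+ 1ℤ ℤ.- u) ≡ v ℤ.+ 1ℤ
      move-x = solve-∀
      move-y : ∀ u v → u ℤ.+ (v ℤ.- u) ≡ v ℤ.+ 0ℤ
      move-y = solve-∀

    moved-right-of-a : ∀ {d} → d ∈ cells Q → proj₁ a ℤ.< proj₁ d ℤ.+ dx
    moved-right-of-a {d} d∈Q = begin-strict
      proj₁ a               <⟨ i<i+1 (proj₁ a) ⟩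
      proj₁ a ℤ.+ 1ℤ        ≡⟨ cong proj₁ b↦right-of-a ⟨
      proj₁ b ℤ.+ dx        ≤⟨ ℤₚ.+-monoˡ-≤ dx (proj₂ (proj₂ leftmost) d∈Q) ⟩
      proj₁ d ℤ.+ dx        ∎
      where open ℤₚ.≤-Reasoning

    P∩Q′=∅ : Disjoint (cells P) (cells (translate dx dy Q))
    P∩Q′=∅ (v∈P , v∈Q′) with ∈-map⁻ (shift dx dy) v∈Q′
    ... | d , d∈Q , refl = ℤₚ.<⇒≱ (moved-right-of-a d∈Q) (proj₂ (proj₂ rightmost) v∈P)

    module U = Union P (translate dx dy Q) P∩Q′=∅ (proj₁ (proj₂ rightmost))
                 (∈-map⁺ (shift dx dy) (proj₁ (proj₂ leftmost))) (inj₁ (inj₁ b↦right-of-a))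

  polyomino : Polyomino
  polyomino = U.polyomino

  size-≡ : size polyomino ≡ size P + size Q
  size-≡ = trans U.size-≡ (cong (size P +_) (length-map (shift dx dy) (cells Q)))

  instances-≥ : instances P + instances Q ≤ instances polyomino
  instances-≥ = ℕₚ.≤-trans (ℕₚ.+-monoʳ-≤ (instances P) (instancesIn-map-shift dx dy (unique Q))) U.instances-≥

Realisation : List Cell → Set
Realisation S = Σ[ Q ∈ Polyomino ] size Q ≤ length S × instancesIn S ≤ instances Q

module Component (S : List Cell) {s : Cell} (s∈S : s ∈ S) (decisions : All (Dec ∘ Reach S s) S) where

  reach? : Decidable (Reach S s)
  reach? d with d ∈? S
  ... | yes d∈S = All.lookup decisions d∈S
  ... | no  d∉S = no (d∉S ∘ Reach-target∈ s∈S)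

  component rest : List Cell
  component = filter reach? S
  rest      = filter (∁? reach?) S

  private
    reach-within : ∀ {d e} → Reach S s d → Reach S d e → Reach component d e
    reach-within s⇝d here               = here
    reach-within s⇝d (step e∈S d~e e⇝) = step (∈-filter⁺ reach? e∈S s⇝e) d~e (reach-within s⇝e e⇝)
      where s⇝e = Reach-snoc s⇝d e∈S d~e

    s∈component : s ∈ component
    s∈component = ∈-filter⁺ reach? s∈S here

  polyomino : Unique S → Polyomino
  polyomino u = record
    { cells     = component
    ; unique    = Unique.filter⁺ reach? u
    ; nonempty  = ∈⇒≢[] s∈component
    ; connected = connected-via s∈component (reach-within here ∘ proj₂ ∘ ∈-filter⁻ reach? {xs = S})
    }

  length-split : length component + length rest ≡ length S
  length-split = length-filter-∁ reach? S

  rest-shorter : length rest < length S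
  rest-shorter = filter-notAll (∁? reach?) S (Any.map (λ { refl s↛s → s↛s here }) s∈S)

  rest-unique : Unique S → Unique rest
  rest-unique = Unique.filter⁺ (∁? reach?)

  instances-split : Unique S → instancesIn S ≤ instancesIn component + instancesIn rest
  instances-split u = instancesIn-split reach? u (λ d∈S c~d s⇝c → Reach-snoc s⇝c d∈S c~d)

realise-from-split : ∀ {S} (PA : Polyomino) (B : List Cell) → size PA + length B ≤ length S →
                     instancesIn S ≤ instances PA + instancesIn B →
                     (B ≢ [] → ¬ ¬ Realisation B) → ¬ ¬ Realisation S
realise-from-split {S} PA [] size≤ instances≤ _ = pure (PA , size-PA≤ , instances-PA≥)
  where
  open RawMonad ¬¬-Monad
  size-PA≤ : size PA ≤ length S
  size-PA≤ = subst (_≤ length S) (ℕₚ.+-identityʳ (size PA)) size≤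
  instances-PA≥ : instancesIn S ≤ instances PA
  instances-PA≥ = subst (instancesIn S ≤_) (ℕₚ.+-identityʳ (instances PA)) instances≤
realise-from-split {S} PA B@(_ ∷ _) size≤ instances≤ realise-B = ¬¬-map juxtapose (realise-B λ ())
  where
  juxtapose : Realisation B → Realisation S
  juxtapose (QB , size-QB≤ , instances-QB≥) = J.polyomino , size-J≤ , instances-J≥
    where
    module J = Juxtapose PA QB
    open ℕₚ.≤-Reasoning
    size-J≤ : size J.polyomino ≤ length S
    size-J≤ = begin
      size J.polyomino        ≡⟨ J.size-≡ ⟩
      size PA + size QB       ≤⟨ ℕₚ.+-monoʳ-≤ (size PA) size-QB≤ ⟩
      size PA + length B      ≤⟨ size≤ ⟩
      length S                ∎
    instances-J≥ : instancesIn S ≤ instances J.polyomino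
    instances-J≥ = begin
      instancesIn S                  ≤⟨ instances≤ ⟩
      instances PA + instancesIn B   ≤⟨ ℕₚ.+-monoʳ-≤ (instances PA) instances-QB≥ ⟩
      instances PA + instances QB    ≤⟨ J.instances-≥ ⟩
      instances J.polyomino          ∎

-- Splitting off the component of a cell needs reachability to be decided, which is only
-- available classically; the double negation is harmless since realisations are only used
-- to refute minimality.
realise : ∀ S → Acc (_<_ on length) S → Unique S → S ≢ [] → ¬ ¬ Realisation S
realise []        _             _ S≢[] = contradiction refl S≢[]
realise S@(_ ∷ _) (acc shorter) u _    = do
  decisions ← All.sequenceM _ ¬¬-Monad (All.tabulate λ _ → ¬¬-excluded-middle)
  let open Component S (here refl) decisions
  realise-from-split {S} (polyomino u) rest (ℕₚ.≤-reflexive length-split) (instances-split u)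
                     (realise rest (shorter rest-shorter) (rest-unique u))
  where open RawMonad ¬¬-Monad

realisable : ∀ S → Unique S → S ≢ [] → ¬ ¬ Realisation S
realisable S = realise S (On.wellFounded length <-wellFounded S)

Covered : Polyomino → Cell → Set
Covered P c = IsC P c ⊎ IsT P c ⊎ IsR P c

Covered? : (P : Polyomino) → Decidable (Covered P)
Covered? P c = IsC? P c ⊎-dec IsT? P c ⊎-dec IsR? P c

instance-cells-covered : ∀ P {t} → LIn P t →
  (Covered P (shift 0ℤ 0ℤ t) × Covered P (shift 1ℤ 0ℤ t)) × Covered P (shift 0ℤ 1ℤ t)
instance-cells-covered P {t} inst =
  ( inj₁ (subst (LIn P) (sym (shift-zero t)) inst)
  , inj₂ (inj₂ (subst (LIn P) (sym (shift-inverse 1ℤ 0ℤ t)) inst)) )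
  , inj₂ (inj₁ (subst (LIn P) (sym (shift-inverse 0ℤ 1ℤ t)) inst))

without : Cell → List Cell → List Cell
without c = filter (λ d → ¬? (d ≟ᶜ c))

instances≤instancesIn-without : ∀ P {c} → ¬ Covered P c → instances P ≤ instancesIn (without c (cells P))
instances≤instancesIn-without P {c} uncovered =
  instancesIn-filter (λ d → ¬? (d ≟ᶜ c)) (unique P) (λ {t} → avoids-c {t})
  where
  ≢c : ∀ {d} → Covered P d → d ≢ c
  ≢c covered d≡c = uncovered (subst (Covered P) d≡c covered)
  avoids-c : ∀ {t} → LIn P t → (shift 0ℤ 0ℤ t ≢ c × shift 1ℤ 0ℤ t ≢ c) × shift 0ℤ 1ℤ t ≢ c
  avoids-c {t} inst with instance-cells-covered P {t} inst
  ... | (c₀ , c₁) , c₂ = (≢c c₀ , ≢c c₁) , ≢c c₂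

minimal⇒covered : ∀ N .{{_ : NonZero N}} P → MinimalFor N P → ∀ {c} → c ∈ cells P → Covered P c
minimal⇒covered N P (N≤#P , minimal) {c} c∈P = decidable-stable (Covered? P c) λ uncovered →
  let N≤#S = ℕₚ.≤-trans N≤#P (instances≤instancesIn-without P uncovered) in
  realisable S (Unique.filter⁺ _ (unique P)) (S≢[] N≤#S) λ (Q , size-Q≤ , instances-Q≥) →
    ℕₚ.<-irrefl refl (begin-strict
      size P    ≤⟨ minimal Q (ℕₚ.≤-trans N≤#S instances-Q≥) ⟩
      size Q    ≤⟨ size-Q≤ ⟩
      length S  <⟨ S-shorter ⟩
      size P    ∎)
  where
  open ℕₚ.≤-Reasoning
  S = without c (cells P)
  S-shorter : length S < size P
  S-shorter = filter-notAll (λ d → ¬? (d ≟ᶜ c)) (cells P) (Any.map (λ { refl c≢c → c≢c refl }) c∈P)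
  S≢[] : N ≤ instancesIn S → S ≢ []
  S≢[] N≤#S S≡[] = ℕₚ.<⇒≱ (>-nonZero⁻¹ N) (subst (λ S → N ≤ instancesIn S) S≡[] N≤#S)

size-decomposition : ∀ P → (∀ {c} → c ∈ cells P → Covered P c) →
  size P ≡ length (Xc P) + length (St P) + length (Sr P) + length (Str P)
size-decomposition P = length-cover (IsC? P) (IsT? P) (IsR? P) (cells P)

lemma7p2 : (N : ℕ) → .{{_ : NonZero N}} → (P : Polyomino) → MinimalFor N P →
    (size P ≡ length (Xc P) + length (St P) + length (Sr P) + length (Str P))
    × (length (Xc P) + (width P ⊔ height P) ≤ size P)
lemma7p2 N P minimal = size-decomposition P (minimal⇒covered N P minimal) , #central+width⊔height≤size P
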